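{- In $\mathcal{U}_h(\mathfrak{sl}_{n+1})$, for $1\le i<j\le n$, $$\mathsf{x}_{i,j}=\sum_{D\in\mathcal{D}_{i,j}}q^{D}\,\mathsf{x}_D.$$
   Context: $\mathcal{U}_h(\mathfrak{sl}_{n+1})$ ($n\ge1$) is the $h$-adically complete $\mathbb{C}[[h]]$-algebra topologically generated by $\mathsf{x}_i,\mathsf{y}_i,\mathsf{H}_i$ ($1\le i\le n$) subject to: $[\mathsf{H}_i,\mathsf{H}_j]=0$; $[\mathsf{H}_i,\mathsf{x}_j]=2\mathsf{x}_j$ if $j=i$, $-\mathsf{x}_j$ if $|i-j|=1$, $0$ otherwise; $[\mathsf{H}_i,\mathsf{y}_j]=-2\mathsf{y}_j$ if $j=i$, $\mathsf{y}_j$ if $|i-j|=1$, $0$ otherwise; $[\mathsf{x}_i,\mathsf{y}_j]=\delta_{ij}\frac{\mathsf{k}_i^2-\mathsf{k}_i^{ -2}}{q-q^{ -1}}$ with $\mathsf{k}_i=e^{h\mathsf{H}_i/4}$, $q=e^{h/2}$; $\mathsf{x}_i\mathsf{x}_j=\mathsf{x}_j\mathsf{x}_i$, $\mathsf{y}_i\mathsf{y}_j=\mathsf{y}_j\mathsf{y}_i$ for $|i-j|>1$; and for $|i-j|=1$ the $q$-Serre relations $\mathsf{x}_i^2\mathsf{x}_j-(q+q^{ -1})\mathsf{x}_i\mathsf{x}_j\mathsf{x}_i+\mathsf{x}_j\mathsf{x}_i^2=0$ and likewise for $\mathsf{y}$. Set $\mathsf{x}_{i,i}=\mathsf{x}_i$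 and inductively $\mathsf{x}_{i,j}=q^{\frac12}\mathsf{x}_i\mathsf{x}_{i+1,j}-q^{ -\frac12}\mathsf{x}_{i+1,j}\mathsf{x}_i$ for $i<j$. Let $P_{i,j}$ be the path graph on vertices $i,i+1,\dots,j$ with edges $\{\ell,\ell+1\}$, and $\mathcal{D}_{i,j}$ the set of its $2^{j-i}$ orientations. For $D\in\mathcal{D}_{i,j}$ let $D_\rightarrow$ (resp. $D_\leftarrow$) be the number of edges oriented $\ell\to\ell+1$ (resp. $\ell\leftarrow\ell+1$), and $q^D=(-1)^{D_\leftarrow}q^{\frac12(D_\rightarrow-D_\leftarrow)}$. The monomial $\mathsf{x}_D$ is built by starting from $\mathsf{x}_j$ and, for $\ell=j-1,j-2,\dots,i$ in turn, placing $\mathsf{x}_\ell$ at the left end of the current word if $\ell\to\ell+1$ in $D$ and at the right end if $\ell\leftarrow\ell+1$ in $D$. -}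

module Defs where

open import Level using (_⊔_)
open import Algebra.Bundles using (Ring)
open import Data.Nat using (ℕ; zero; suc; _∸_; _≤_; _<_)
open import Data.Bool using (Bool; true; false)
open import Data.Vec using (Vec; []; _∷_)
open import Data.List using (List; []; _∷_; map; _++_; foldr)
open import Data.Sum using (_⊎_)
open import Relation.Binary.PropositionalEquality using (_≡_)

-- Orientations of the path graph with m edges: a vector of m Booleans,
-- the k-th entry describing edge {i+k, i+k+1};  true = (ℓ → ℓ+1), false = (ℓ ← ℓ+1).
allOrientations : (m : ℕ) → List (Vec Bool m)
allOrientations zero = [] ∷ []
allOrientations (suc m) =
  map (true ∷_) (allOrientations m) ++ map (false ∷_) (allOrientations m)

#→ : ∀ {m} → Vec Bool m → ℕ
#→ [] = 0
#→ (true ∷ d) = suc (#→ d)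
#→ (false ∷ d) = #→ d

#← : ∀ {m} → Vec Bool m → ℕ
#← [] = 0
#← (true ∷ d) = #← d
#← (false ∷ d) = suc (#← d)

module _ {c ℓ} (R : Ring c ℓ) where
  open Ring R

  _−_ : Carrier → Carrier → Carrier
  a − b = a + (- b)

  pow : Carrier → ℕ → Carrier
  pow a zero = 1#
  pow a (suc k) = a * pow a k

  ringSum : List Carrier → Carrier
  ringSum = foldr _+_ 0#

  -- s plays the role of q^{1/2}, s⁻ of q^{-1/2}.
  -- x_{i,i+m} by the recursive definition.
  xSeg : (s s⁻ : Carrier) (x : ℕ → Carrier) (i m : ℕ) → Carrier
  xSeg s s⁻ x i zero = x i
  xSeg s s⁻ x i (suc m) =
    (s * (x i * xSeg s s⁻ x (suc i) m)) − (s⁻ * (xSeg s s⁻ x (suc i) m * x i))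

  xRoot : (s s⁻ : Carrier) (x : ℕ → Carrier) (i j : ℕ) → Carrier
  xRoot s s⁻ x i j = xSeg s s⁻ x i (j ∸ i)

  -- the monomial x_D for an orientation D of the path i, i+1, …, i+m.
  -- Placing x_i last (left end if i → i+1, right end otherwise) on the word
  -- built for the sub-path i+1, …, i+m.
  xD : (x : ℕ → Carrier) (i : ℕ) → ∀ {m} → Vec Bool m → Carrier
  xD x i [] = x i
  xD x i (true ∷ d) = x i * xD x (suc i) d
  xD x i (false ∷ d) = xD x (suc i) d * x i

  -- q^D = (-1)^{D←} q^{(D→ - D←)/2}
  qD : (s s⁻ : Carrier) → ∀ {m} → Vec Bool m → Carrier
  qD s s⁻ d = pow (- 1#) (#← d) * (pow s (#→ d) * pow s⁻ (#← d))

  -- The data of the x-part of U_h(sl_{n+1}) inside an arbitrary ring: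
  -- s = q^{1/2} central and invertible, x_1..x_n satisfying the x-relations.
  record XData (n : ℕ) : Set (c ⊔ ℓ) where
    field
      s s⁻ : Carrier
      x : ℕ → Carrier
      s-inv₁ : s * s⁻ ≈ 1#
      s-inv₂ : s⁻ * s ≈ 1#
      s-central : ∀ a → s * a ≈ a * s
      x-comm : ∀ a b → 1 ≤ a → a ≤ n → 1 ≤ b → b ≤ n →
               (suc (suc a) ≤ b ⊎ suc (suc b) ≤ a) → x a * x b ≈ x b * x a
      x-serre : ∀ a b → 1 ≤ a → a ≤ n → 1 ≤ b → b ≤ n →
               (suc a ≡ b ⊎ suc b ≡ a) →
               ((x a * x a) * x b − ((s * s + s⁻ * s⁻) * (x a * x b * x a)))
                 + x b * (x a * x a) ≈ 0#

module Submission where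

-- Write x_{i,i+m}
-- for the recursively defined root vector and S i m for the orientation sum.
-- Orientations of a path with m+1 edges are those of the sub-path i+1 … i+m+1
-- extended by the edge {i,i+1}, oriented either way; the two kinds of
-- extension change the weight and the monomial by
--   q^{→D} x_{→D} = s · x_i (q^D x_D),   q^{←D} x_{←D} = −s⁻ · (q^D x_D) x_i,
-- using that q^D is central.  Since both operations are additive, summing
-- gives  S i (m+1) = s x_i S(i+1,m) − s⁻ S(i+1,m) x_i,  which is the defining
-- recursion of x_{i,i+m+1}; induction on m finishes the proof.

open import Defs
open import Algebra.Bundles using (Ring)
open import Data.Nat using (ℕ; zero; suc; _∸_; _≤_; _<_)
open import Data.List using (List; []; _∷_; map; _++_)
open import Data.Vec using (Vec; []; _∷_)
open import Data.Bool using (Bool; true; false)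
open import Level using (_⊔_)
import Algebra.Properties.Ring as RingProperties
import Relation.Binary.Reasoning.Setoid as SetoidReasoning

module RingFacts {c ℓ} (R : Ring c ℓ) where
  open Ring R
  open RingProperties R
  open SetoidReasoning setoid

  Central : Carrier → Set _
  Central a = ∀ y → a * y ≈ y * a

  central-1 : Central 1#
  central-1 y = trans (*-identityˡ y) (sym (*-identityʳ y))

  central-−1 : Central (- 1#)
  central-−1 y = begin
    - 1# * y      ≈⟨ -1*x≈-x y ⟩
    - y           ≈⟨ -‿cong (sym (*-identityʳ y)) ⟩
    - (y * 1#)    ≈⟨ -‿distribʳ-* y 1# ⟩
    y * - 1#      ∎

  central-* : ∀ {a b} → Central a → Central b → Central (a * b)
  central-* {a} {b} ca cb y = begin
    (a * b) * y   ≈⟨ *-assoc a b y ⟩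
    a * (b * y)   ≈⟨ *-congˡ (cb y) ⟩
    a * (y * b)   ≈⟨ sym (*-assoc a y b) ⟩
    (a * y) * b   ≈⟨ *-congʳ (ca y) ⟩
    (y * a) * b   ≈⟨ *-assoc y a b ⟩
    y * (a * b)   ∎

  central-pow : ∀ {a} → Central a → ∀ k → Central (pow R a k)
  central-pow ca zero    = central-1
  central-pow ca (suc k) = central-* ca (central-pow ca k)

  central-inverse : ∀ {a b} → Central a → a * b ≈ 1# → b * a ≈ 1# → Central b
  central-inverse {a} {b} ca ab≈1 ba≈1 y = begin
    b * y               ≈⟨ *-congˡ (sym (*-identityʳ y)) ⟩
    b * (y * 1#)        ≈⟨ *-congˡ (*-congˡ (sym ab≈1)) ⟩
    b * (y * (a * b))   ≈⟨ *-congˡ (sym (*-assoc y a b)) ⟩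
    b * ((y * a) * b)   ≈⟨ *-congˡ (*-congʳ (sym (ca y))) ⟩
    b * ((a * y) * b)   ≈⟨ *-congˡ (*-assoc a y b) ⟩
    b * (a * (y * b))   ≈⟨ sym (*-assoc b a (y * b)) ⟩
    (b * a) * (y * b)   ≈⟨ *-congʳ ba≈1 ⟩
    1# * (y * b)        ≈⟨ *-identityˡ (y * b) ⟩
    y * b               ∎

  central-past-left : ∀ {q} → Central q → ∀ a y → q * (a * y) ≈ a * (q * y)
  central-past-left {q} cq a y = begin
    q * (a * y)   ≈⟨ sym (*-assoc q a y) ⟩
    (q * a) * y   ≈⟨ *-congʳ (cq a) ⟩
    (a * q) * y   ≈⟨ *-assoc a q y ⟩
    a * (q * y)   ∎

  record IsAdditive (φ : Carrier → Carrier) : Set (c ⊔ ℓ) where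
    field
      cong : ∀ {a b} → a ≈ b → φ a ≈ φ b
      hom-+ : ∀ a b → φ (a + b) ≈ φ a + φ b
      hom-0 : φ 0# ≈ 0#

  left-mult-additive : ∀ a → IsAdditive (a *_)
  left-mult-additive a = record
    { cong = *-congˡ ; hom-+ = distribˡ a ; hom-0 = zeroʳ a }

  right-mult-additive : ∀ a → IsAdditive (_* a)
  right-mult-additive a = record
    { cong = *-congʳ ; hom-+ = λ u v → distribʳ a u v ; hom-0 = zeroˡ a }

  negation-additive : IsAdditive (λ a → - a)
  negation-additive = record
    { cong = -‿cong ; hom-+ = λ u v → sym (-‿+-comm u v) ; hom-0 = -0#≈0# }

  compose-additive : ∀ {φ ψ} → IsAdditive φ → IsAdditive ψ → IsAdditive (λ a → φ (ψ a))
  compose-additive {φ} {ψ} Aφ Aψ = record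
    { cong  = λ e → Φ.cong (Ψ.cong e)
    ; hom-+ = λ u v → trans (Φ.cong (Ψ.hom-+ u v)) (Φ.hom-+ (ψ u) (ψ v))
    ; hom-0 = trans (Φ.cong Ψ.hom-0) Φ.hom-0
    }
    where
    module Φ = IsAdditive Aφ
    module Ψ = IsAdditive Aψ

  sum-++ : ∀ {a} {A : Set a} (f : A → Carrier) (xs ys : List A) →
    ringSum R (map f (xs ++ ys)) ≈ ringSum R (map f xs) + ringSum R (map f ys)
  sum-++ f []       ys = sym (+-identityˡ _)
  sum-++ f (a ∷ xs) ys = trans (+-congˡ (sum-++ f xs ys)) (sym (+-assoc _ _ _))

  sum-additive : ∀ {a b} {A : Set a} {B : Set b} {φ : Carrier → Carrier} →
    IsAdditive φ → (f : A → Carrier) (g : B → Carrier) (h : B → A) →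
    (∀ d → f (h d) ≈ φ (g d)) → (L : List B) →
    ringSum R (map f (map h L)) ≈ φ (ringSum R (map g L))
  sum-additive Aφ f g h pointwise []      = sym (IsAdditive.hom-0 Aφ)
  sum-additive {φ = φ} Aφ f g h pointwise (d ∷ L) = begin
    f (h d) + ringSum R (map f (map h L))
      ≈⟨ +-cong (pointwise d) (sum-additive Aφ f g h pointwise L) ⟩
    φ (g d) + φ (ringSum R (map g L))
      ≈⟨ sym (IsAdditive.hom-+ Aφ _ _) ⟩
    φ (g d + ringSum R (map g L)) ∎

module Expansion {c ℓ} (R : Ring c ℓ) (n : ℕ) (X : XData R n) where
  open Ring R
  open XData X
  open RingProperties R
  open RingFacts R
  open SetoidReasoning setoid

  central-s⁻ : Central s⁻
  central-s⁻ = central-inverse s-central s-inv₁ s-inv₂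

  weight : ∀ {m} → Vec Bool m → Carrier
  weight = qD R s s⁻

  central-weight : ∀ {m} (d : Vec Bool m) → Central (weight d)
  central-weight d =
    central-* (central-pow central-−1 (#← d))
              (central-* (central-pow s-central (#→ d)) (central-pow central-s⁻ (#← d)))

  weight-right : ∀ {m} (d : Vec Bool m) → weight (true ∷ d) ≈ s * weight d
  weight-right d = begin
    A * ((s * B) * C)   ≈⟨ *-congˡ (*-assoc s B C) ⟩
    A * (s * (B * C))   ≈⟨ central-past-left (central-pow central-−1 (#← d)) s (B * C) ⟩
    s * (A * (B * C))   ∎
    where
    A = pow R (- 1#) (#← d)
    B = pow R s (#→ d)
    C = pow R s⁻ (#← d)

  weight-left : ∀ {m} (d : Vec Bool m) → weight (false ∷ d) ≈ - (s⁻ * weight d)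
  weight-left d = begin
    (- 1# * A) * (B * (s⁻ * C))   ≈⟨ *-cong (-1*x≈-x A) (central-past-left (central-pow s-central (#→ d)) s⁻ C) ⟩
    (- A) * (s⁻ * (B * C))        ≈⟨ sym (-‿distribˡ-* A _) ⟩
    - (A * (s⁻ * (B * C)))        ≈⟨ -‿cong (central-past-left (central-pow central-−1 (#← d)) s⁻ (B * C)) ⟩
    - (s⁻ * (A * (B * C)))        ∎
    where
    A = pow R (- 1#) (#← d)
    B = pow R s (#→ d)
    C = pow R s⁻ (#← d)

  term : ℕ → ∀ {m} → Vec Bool m → Carrier
  term i d = weight d * xD R x i d

  orientationSum : ℕ → ℕ → Carrier
  orientationSum i m = ringSum R (map (term i) (allOrientations m))

  extendRight extendLeft : ℕ → Carrier → Carrier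
  extendRight i y = s * (x i * y)
  extendLeft  i y = - (s⁻ * (y * x i))

  extendRight-additive : ∀ i → IsAdditive (extendRight i)
  extendRight-additive i = compose-additive (left-mult-additive s) (left-mult-additive (x i))

  extendLeft-additive : ∀ i → IsAdditive (extendLeft i)
  extendLeft-additive i =
    compose-additive negation-additive
      (compose-additive (left-mult-additive s⁻) (right-mult-additive (x i)))

  term-right : ∀ i {m} (d : Vec Bool m) → term i (true ∷ d) ≈ extendRight i (term (suc i) d)
  term-right i d = begin
    weight (true ∷ d) * (x i * Y)   ≈⟨ *-congʳ (weight-right d) ⟩
    (s * Q) * (x i * Y)             ≈⟨ *-assoc s Q (x i * Y) ⟩
    s * (Q * (x i * Y))             ≈⟨ *-congˡ (central-past-left (central-weight d) (x i) Y) ⟩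
    s * (x i * (Q * Y))             ∎
    where
    Q = weight d
    Y = xD R x (suc i) d

  term-left : ∀ i {m} (d : Vec Bool m) → term i (false ∷ d) ≈ extendLeft i (term (suc i) d)
  term-left i d = begin
    weight (false ∷ d) * (Y * x i)  ≈⟨ *-congʳ (weight-left d) ⟩
    (- (s⁻ * Q)) * (Y * x i)        ≈⟨ sym (-‿distribˡ-* _ _) ⟩
    - ((s⁻ * Q) * (Y * x i))        ≈⟨ -‿cong (*-assoc s⁻ Q (Y * x i)) ⟩
    - (s⁻ * (Q * (Y * x i)))        ≈⟨ -‿cong (*-congˡ (sym (*-assoc Q Y (x i)))) ⟩
    - (s⁻ * ((Q * Y) * x i))        ∎
    where
    Q = weight d
    Y = xD R x (suc i) d

  orientationSum-suc : ∀ i m →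
    orientationSum i (suc m)
      ≈ extendRight i (orientationSum (suc i) m) + extendLeft i (orientationSum (suc i) m)
  orientationSum-suc i m = begin
    orientationSum i (suc m)
      ≈⟨ sum-++ (term i) (map (true ∷_) L) (map (false ∷_) L) ⟩
    ringSum R (map (term i) (map (true ∷_) L)) + ringSum R (map (term i) (map (false ∷_) L))
      ≈⟨ +-cong (sum-additive (extendRight-additive i) (term i) (term (suc i)) (true ∷_) (term-right i) L)
                (sum-additive (extendLeft-additive i) (term i) (term (suc i)) (false ∷_) (term-left i) L) ⟩
    extendRight i (orientationSum (suc i) m) + extendLeft i (orientationSum (suc i) m) ∎
    where
    L = allOrientations m

  expansion : ∀ i m → xSeg R s s⁻ x i m ≈ orientationSum i m
  expansion i zero = begin
    x i                           ≈⟨ sym (*-identityˡ (x i)) ⟩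
    1# * x i                      ≈⟨ *-congʳ (sym (trans (*-identityˡ _) (*-identityˡ 1#))) ⟩
    weight ([] {A = Bool}) * x i  ≈⟨ sym (+-identityʳ _) ⟩
    orientationSum i 0            ∎
  expansion i (suc m) = begin
    extendRight i Y + extendLeft i Y
      ≈⟨ +-cong (IsAdditive.cong (extendRight-additive i) IH) (IsAdditive.cong (extendLeft-additive i) IH) ⟩
    extendRight i (orientationSum (suc i) m) + extendLeft i (orientationSum (suc i) m)
      ≈⟨ sym (orientationSum-suc i m) ⟩
    orientationSum i (suc m) ∎
    where
    Y = xSeg R s s⁻ x (suc i) m
    IH = expansion (suc i) m

lemma5p5 : ∀ {c ℓ} (R : Ring c ℓ) (n : ℕ) (X : XData R n) (i j : ℕ) →
    1 ≤ i → i < j → j ≤ n →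
    let open Ring R
        open XData X
    in xRoot R s s⁻ x i j
       ≈ ringSum R (map (λ D → qD R s s⁻ D * xD R x i D) (allOrientations (j ∸ i)))
lemma5p5 R n X i j _ _ _ = Expansion.expansion R n X i (j ∸ i)
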